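{- Let $G=(V,E)$ be an $n$-vertex graph with edge weights $w_{ij}\in[0,1]$ in which every vertex has (weighted) degree $\delta n$. Then for every positive integer $k$, $\rho_G(k)\ge1-\frac{1}{\delta k}$.
   Context: For $A\subseteq V$, $\mathrm{vol}(A)=\sum_{i\in A}\deg(i)$ and $E(A,B)$ is the total weight of edges from $A$ to $B$. The conductance of a nonempty $A\subseteq V$ is $\phi_G(A)=E(A,V\setminus A)/\mathrm{vol}(A)$. The multi-way conductance is $\rho_G(k)=\min_{A_1,\ldots,A_k}\max_{j\in[k]}\phi_G(A_j)$, the minimum over pairwise disjoint nonempty subsets $A_1,\ldots,A_k\subseteq V$.
   Formalization: The edge weights $w_{ij}$ and the degree parameter δ take values in the rationals. -}

module Defs where

open import Data.Nat as ℕ using (ℕ; zero; suc)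
open import Data.Fin using (Fin; zero; suc)
open import Data.Fin.Subset using (Subset; _∈_; _∉_; Nonempty; Empty; _∩_)
open import Data.Bool using (true; false)
open import Data.Vec using (lookup)
open import Data.Integer using (+_)
open import Data.Rational using (ℚ; 0ℚ; 1ℚ; _+_; _*_; _-_; _÷_; _/_; _≤_; _≥_; ≢-nonZero)
open import Data.Rational.Properties using (_≟_)
open import Data.Product using (∃; Σ; _×_)
open import Relation.Nullary using (yes; no; ¬_)
open import Relation.Binary.PropositionalEquality using (_≡_; _≢_)

ℕ→ℚ : ℕ → ℚ
ℕ→ℚ m = + m / 1

Σℚ : {n : ℕ} → (Fin n → ℚ) → ℚ
Σℚ {zero}  f = 0ℚ
Σℚ {suc n} f = f zero + Σℚ (λ i → f (suc i))

-- Division, with the (never used under our hypotheses) convention p / 0 := 0.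
_÷₀_ : ℚ → ℚ → ℚ
p ÷₀ q with q ≟ 0ℚ
... | yes _  = 0ℚ
... | no q≢0 = _÷_ p q {{≢-nonZero q≢0}}

𝟙 : {n : ℕ} → Subset n → Fin n → ℚ
𝟙 A i with lookup A i
... | true  = 1ℚ
... | false = 0ℚ

Weights : ℕ → Set
Weights n = Fin n → Fin n → ℚ

deg : {n : ℕ} → Weights n → Fin n → ℚ
deg w i = Σℚ (λ j → w i j)

vol : {n : ℕ} → Weights n → Subset n → ℚ
vol w A = Σℚ (λ i → 𝟙 A i * deg w i)

E : {n : ℕ} → Weights n → Subset n → Subset n → ℚ
E w A B = Σℚ (λ i → Σℚ (λ j → 𝟙 A i * 𝟙 B j * w i j))

compl : {n : ℕ} → Subset n → Subset n
compl = Data.Fin.Subset.∁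

φ : {n : ℕ} → Weights n → Subset n → ℚ
φ w A = E w A (compl A) ÷₀ vol w A

DisjointNonemptyFamily : {n : ℕ} → (k : ℕ) → (Fin k → Subset n) → Set
DisjointNonemptyFamily {n} k A =
  ((j : Fin k) → Nonempty (A j)) ×
  ((a b : Fin k) → a ≢ b → Empty (A a ∩ A b))

-- ρ_G(k) ≥ c : the min over all such families of max_j φ(A_j) is ≥ c,
-- i.e. every family has some member of conductance ≥ c
-- (vacuous when no such family exists, matching min ∅ = +∞).
ρ≥ : {n : ℕ} → Weights n → ℕ → ℚ → Set
ρ≥ {n} w k c = (A : Fin k → Subset n) → DisjointNonemptyFamily k A →
  ∃ λ (j : Fin k) → φ w (A j) ≥ c

IsWeightedGraph : {n : ℕ} → Weights n → Set
IsWeightedGraph {n} w =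
  ((i j : Fin n) → (0ℚ ≤ w i j) × (w i j ≤ 1ℚ)) ×
  ((i j : Fin n) → w i j ≡ w j i) ×
  ((i : Fin n) → w i i ≡ 0ℚ)

-- The k sets are disjoint, so their sizes sum to at most n and pigeonhole
-- gives a member A of the family with k·|A| ≤ n. In a δn-regular
-- graph vol(A) = |A|·δn, and since weights are at most 1 the edges inside A
-- weigh at most |A|², so E(A, V∖A) = vol(A) − E(A, A) ≥ |A|·δn − |A|², i.e.
-- φ(A) ≥ 1 − |A|/(δn) ≥ 1 − 1/(δk).

module Submission where

open import Defs
open import Data.Nat using (ℕ; NonZero; zero; suc)
import Data.Nat.Coprimality as Coprimality
open import Data.Fin using (Fin; zero; suc)
open import Data.Fin.Properties using (suc-injective; ¬∀⟶∃¬)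
open import Data.Fin.Subset using (Subset; _∈_; Empty; _∩_)
open import Data.Fin.Subset.Properties using (x∈p∩q⁺)
open import Data.Bool using (true; false; not)
open import Data.Vec using (lookup)
open import Data.Vec.Properties using (lookup-map; lookup⇒[]=; []=⇒lookup)
import Data.Integer as ℤ
open import Data.Integer.Tactic.RingSolver using (solve-∀)
open import Data.Rational
  using (ℚ; 0ℚ; 1ℚ; mkℚ; _+_; _*_; _-_; _<_; _≤_; 1/_; ≢-nonZero; positive; nonNegative)
open import Data.Rational.Properties
open import Data.Rational.Solver using (module +-*-Solver)
import Data.Rational.Unnormalised as ℚᵘ using (*≡*)
import Data.Rational.Unnormalised.Properties as ℚᵘ using (≃-trans; ≃-sym)
open import Algebra.Bundles using (CommutativeRing)
open import Algebra.Properties.Semiring.Sum (CommutativeRing.semiring +-*-commutativeRing)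
  using (sum; ∑-distrib-+; ∑-comm; *-distribˡ-sum; *-distribʳ-sum)
open import Data.Product using (∃; _×_; _,_; proj₁; proj₂)
open import Data.Sum using (_⊎_; inj₁; inj₂)
open import Data.Empty using (⊥-elim; ⊥-elim-irr)
open import Function using (_∘_)
open import Relation.Nullary using (¬_; yes; no)
open import Relation.Binary.PropositionalEquality
  using (_≡_; _≢_; _≗_; refl; sym; trans; cong; cong₂; subst; module ≡-Reasoning)
open +-*-Solver

private
  variable
    n k : ℕ

Σℚ≡sum : (f : Fin n → ℚ) → Σℚ f ≡ sum f
Σℚ≡sum {zero}  f = refl
Σℚ≡sum {suc n} f = cong (f zero +_) (Σℚ≡sum (f ∘ suc))

Σℚ-cong : {f g : Fin n → ℚ} → f ≗ g → Σℚ f ≡ Σℚ g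
Σℚ-cong {zero}  f≗g = refl
Σℚ-cong {suc n} f≗g = cong₂ _+_ (f≗g zero) (Σℚ-cong (f≗g ∘ suc))

Σℚ-distrib-+ : (f g : Fin n → ℚ) → Σℚ (λ i → f i + g i) ≡ Σℚ f + Σℚ g
Σℚ-distrib-+ f g = begin
  Σℚ (λ i → f i + g i)  ≡⟨ Σℚ≡sum (λ i → f i + g i) ⟩
  sum (λ i → f i + g i) ≡⟨ ∑-distrib-+ f g ⟩
  sum f + sum g         ≡⟨ sym (cong₂ _+_ (Σℚ≡sum f) (Σℚ≡sum g)) ⟩
  Σℚ f + Σℚ g           ∎
  where open ≡-Reasoning

Σℚ-comm : ∀ {m} (f : Fin m → Fin n → ℚ) →
          Σℚ (λ i → Σℚ (λ j → f i j)) ≡ Σℚ (λ j → Σℚ (λ i → f i j))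
Σℚ-comm f = begin
  Σℚ (λ i → Σℚ (f i))            ≡⟨ Σℚ-cong (λ i → Σℚ≡sum (f i)) ⟩
  Σℚ (λ i → sum (f i))           ≡⟨ Σℚ≡sum (λ i → sum (f i)) ⟩
  sum (λ i → sum (f i))          ≡⟨ ∑-comm f ⟩
  sum (λ j → sum (λ i → f i j))  ≡⟨ sym (Σℚ≡sum (λ j → sum (λ i → f i j))) ⟩
  Σℚ (λ j → sum (λ i → f i j))   ≡⟨ sym (Σℚ-cong (λ j → Σℚ≡sum (λ i → f i j))) ⟩
  Σℚ (λ j → Σℚ (λ i → f i j))    ∎
  where open ≡-Reasoning

*-distribˡ-Σℚ : ∀ c (f : Fin n → ℚ) → Σℚ (λ i → c * f i) ≡ c * Σℚ f
*-distribˡ-Σℚ c f = begin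
  Σℚ (λ i → c * f i)  ≡⟨ Σℚ≡sum (λ i → c * f i) ⟩
  sum (λ i → c * f i) ≡⟨ sym (*-distribˡ-sum c f) ⟩
  c * sum f           ≡⟨ cong (c *_) (sym (Σℚ≡sum f)) ⟩
  c * Σℚ f            ∎
  where open ≡-Reasoning

*-distribʳ-Σℚ : ∀ c (f : Fin n → ℚ) → Σℚ (λ i → f i * c) ≡ Σℚ f * c
*-distribʳ-Σℚ c f = begin
  Σℚ (λ i → f i * c)  ≡⟨ Σℚ≡sum (λ i → f i * c) ⟩
  sum (λ i → f i * c) ≡⟨ sym (*-distribʳ-sum c f) ⟩
  sum f * c           ≡⟨ cong (_* c) (sym (Σℚ≡sum f)) ⟩
  Σℚ f * c            ∎
  where open ≡-Reasoning

Σℚ-mono-≤ : {f g : Fin n → ℚ} → (∀ i → f i ≤ g i) → Σℚ f ≤ Σℚ g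
Σℚ-mono-≤ {zero}  f≤g = ≤-refl
Σℚ-mono-≤ {suc n} f≤g = +-mono-≤ (f≤g zero) (Σℚ-mono-≤ (f≤g ∘ suc))

Σℚ-mono-< : {f g : Fin (suc n) → ℚ} → (∀ i → f i < g i) → Σℚ f < Σℚ g
Σℚ-mono-< f<g = +-mono-<-≤ (f<g zero) (Σℚ-mono-≤ (<⇒≤ ∘ f<g ∘ suc))

Σℚ-nonNeg : {f : Fin n → ℚ} → (∀ i → 0ℚ ≤ f i) → 0ℚ ≤ Σℚ f
Σℚ-nonNeg {zero}  f≥0 = ≤-refl
Σℚ-nonNeg {suc n} f≥0 = +-mono-≤ (f≥0 zero) (Σℚ-nonNeg (f≥0 ∘ suc))

term≤Σℚ : {f : Fin n → ℚ} → (∀ i → 0ℚ ≤ f i) → ∀ i → f i ≤ Σℚ f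
term≤Σℚ {f = f} f≥0 zero =
  subst (_≤ Σℚ f) (+-identityʳ (f zero)) (+-monoʳ-≤ (f zero) (Σℚ-nonNeg (f≥0 ∘ suc)))
term≤Σℚ {f = f} f≥0 (suc i) =
  subst (_≤ Σℚ f) (+-identityˡ (f (suc i))) (+-mono-≤ (f≥0 zero) (term≤Σℚ (f≥0 ∘ suc) i))

-- ℕ→ℚ m normalises through a gcd; this normal form lets arithmetic on it reduce.
[_/1] : ℕ → ℚ
[ m /1] = mkℚ (ℤ.+ m) 0 (Coprimality.sym (Coprimality.1-coprimeTo m))

ℕ→ℚ≡[/1] : ∀ m → ℕ→ℚ m ≡ [ m /1]
ℕ→ℚ≡[/1] m = ↥p/↧p≡p [ m /1]

ℕ→ℚ-suc : ∀ m → ℕ→ℚ (suc m) ≡ 1ℚ + ℕ→ℚ m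
ℕ→ℚ-suc m rewrite ℕ→ℚ≡[/1] (suc m) | ℕ→ℚ≡[/1] m =
  toℚᵘ-injective (ℚᵘ.≃-trans (ℚᵘ.*≡* (cross-multiplied (ℤ.+ m))) (ℚᵘ.≃-sym (toℚᵘ-homo-+ 1ℚ [ m /1])))
  where
  cross-multiplied : ∀ x → (ℤ.1ℤ ℤ.+ x) ℤ.* (ℤ.1ℤ ℤ.* ℤ.1ℤ) ≡ (ℤ.1ℤ ℤ.* ℤ.1ℤ ℤ.+ x ℤ.* ℤ.1ℤ) ℤ.* ℤ.1ℤ
  cross-multiplied = solve-∀

ℕ→ℚ-pos : ∀ m → 0ℚ < ℕ→ℚ (suc m)
ℕ→ℚ-pos m rewrite ℕ→ℚ≡[/1] (suc m) = positive⁻¹ _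

Fin⇒ℕ→ℚ-pos : Fin n → 0ℚ < ℕ→ℚ n
Fin⇒ℕ→ℚ-pos {suc n} _ = ℕ→ℚ-pos n

Σℚ-const : ∀ n c → Σℚ {n} (λ _ → c) ≡ ℕ→ℚ n * c
Σℚ-const zero    c = sym (*-zeroˡ c)
Σℚ-const (suc n) c = begin
  c + Σℚ {n} (λ _ → c) ≡⟨ cong (c +_) (Σℚ-const n c) ⟩
  c + ℕ→ℚ n * c        ≡⟨ solve 2 (λ c m → c :+ m :* c := (con 1ℚ :+ m) :* c) refl c (ℕ→ℚ n) ⟩
  (1ℚ + ℕ→ℚ n) * c     ≡⟨ cong (_* c) (sym (ℕ→ℚ-suc n)) ⟩
  ℕ→ℚ (suc n) * c      ∎
  where open ≡-Reasoning

pigeonhole : ∀ N (σ : Fin (suc k) → ℚ) → Σℚ σ ≤ N → ∃ λ j → ℕ→ℚ (suc k) * σ j ≤ N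
pigeonhole {k} N σ Σσ≤N = j , ≮⇒≥ N≮Kσj
  where
  K : ℚ
  K = ℕ→ℚ (suc k)
  all-large : ¬ (∀ j → N < K * σ j)
  all-large N<Kσ = <-irrefl refl (begin-strict
    K * N                  ≡⟨ sym (Σℚ-const (suc k) N) ⟩
    Σℚ {suc k} (λ _ → N)   <⟨ Σℚ-mono-< N<Kσ ⟩
    Σℚ (λ j → K * σ j)     ≡⟨ *-distribˡ-Σℚ K σ ⟩
    K * Σℚ σ               ≤⟨ *-monoˡ-≤-nonNeg K {{nonNegative (<⇒≤ (ℕ→ℚ-pos k))}} Σσ≤N ⟩
    K * N                  ∎)
    where open ≤-Reasoning
  small : ∃ λ j → ¬ (N < K * σ j)
  small = ¬∀⟶∃¬ (suc k) (λ j → N < K * σ j) (λ j → N <? K * σ j) all-large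
  j : Fin (suc k)
  j = proj₁ small
  N≮Kσj : ¬ (N < K * σ j)
  N≮Kσj = proj₂ small

*-nonNeg : ∀ {p q} → 0ℚ ≤ p → 0ℚ ≤ q → 0ℚ ≤ p * q
*-nonNeg {p} {q} p≥0 q≥0 =
  nonNegative⁻¹ (p * q) {{nonNeg*nonNeg⇒nonNeg p {{nonNegative p≥0}} q {{nonNegative q≥0}}}}

*-pos : ∀ {p q} → 0ℚ < p → 0ℚ < q → 0ℚ < p * q
*-pos {p} {q} p>0 q>0 = positive⁻¹ (p * q) {{pos*pos⇒pos p {{positive p>0}} q {{positive q>0}}}}

÷₀-*-cancel : ∀ p {q} → 0ℚ < q → (p ÷₀ q) * q ≡ p
÷₀-*-cancel p {q} q>0 with q ≟ 0ℚ
... | yes q≡0 = ⊥-elim (<⇒≢ q>0 (sym q≡0))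
... | no  q≢0 = begin
  p * 1/q * q   ≡⟨ *-assoc p 1/q q ⟩
  p * (1/q * q) ≡⟨ cong (p *_) (*-inverseˡ q {{≢-nonZero q≢0}}) ⟩
  p * 1ℚ        ≡⟨ *-identityʳ p ⟩
  p             ∎
  where
  open ≡-Reasoning
  1/q : ℚ
  1/q = (1/ q) {{≢-nonZero q≢0}}

÷₀-nonNeg : ∀ {p q} → 0ℚ ≤ p → 0ℚ < q → 0ℚ ≤ p ÷₀ q
÷₀-nonNeg {p} {q} p≥0 q>0 with q ≟ 0ℚ
... | yes _   = ≤-refl
... | no  q≢0 = *-nonNeg p≥0 (<⇒≤ 1/q>0)
  where
  1/q : ℚ
  1/q = (1/ q) {{≢-nonZero q≢0}}
  1/q>0 : 0ℚ < 1/q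
  1/q>0 = positive⁻¹ 1/q {{1/pos⇒pos q {{positive q>0}}}}

≤-÷₀ : ∀ {c p q} → 0ℚ < q → c * q ≤ p → c ≤ p ÷₀ q
≤-÷₀ {c} {p} {q} q>0 cq≤p =
  *-cancelʳ-≤-pos q {{positive q>0}} (subst (c * q ≤_) (sym (÷₀-*-cancel p q>0)) cq≤p)

size : Subset n → ℚ
size A = Σℚ (𝟙 A)

PairwiseDisjoint : (Fin k → Subset n) → Set
PairwiseDisjoint {k} A = (a b : Fin k) → a ≢ b → Empty (A a ∩ A b)

𝟙-∈-or-0 : (A : Subset n) (i : Fin n) → (i ∈ A × 𝟙 A i ≡ 1ℚ) ⊎ 𝟙 A i ≡ 0ℚ
𝟙-∈-or-0 A i with lookup A i in eq
... | true  = inj₁ (lookup⇒[]= i A eq , refl)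
... | false = inj₂ refl

𝟙-∈ : (A : Subset n) {i : Fin n} → i ∈ A → 𝟙 A i ≡ 1ℚ
𝟙-∈ A {i} i∈A rewrite []=⇒lookup i∈A = refl

𝟙-nonNeg : (A : Subset n) (i : Fin n) → 0ℚ ≤ 𝟙 A i
𝟙-nonNeg A i with 𝟙-∈-or-0 A i
... | inj₁ (_ , 𝟙≡1) = subst (0ℚ ≤_) (sym 𝟙≡1) (nonNegative⁻¹ 1ℚ)
... | inj₂ 𝟙≡0       = ≤-reflexive (sym 𝟙≡0)

𝟙+𝟙-compl : (A : Subset n) (i : Fin n) → 𝟙 A i + 𝟙 (compl A) i ≡ 1ℚ
𝟙+𝟙-compl A i rewrite lookup-map i not A with lookup A i
... | true  = +-identityʳ 1ℚ
... | false = +-identityˡ 1ℚ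

1≤size : (A : Subset n) {i : Fin n} → i ∈ A → 1ℚ ≤ size A
1≤size A {i} i∈A = subst (_≤ size A) (𝟙-∈ A i∈A) (term≤Σℚ (𝟙-nonNeg A) i)

Σℚ-𝟙-disjoint≤1 : (A : Fin k → Subset n) → PairwiseDisjoint A →
                  ∀ i → Σℚ (λ j → 𝟙 (A j) i) ≤ 1ℚ
Σℚ-𝟙-disjoint≤1 {zero}  A disjoint i = nonNegative⁻¹ 1ℚ
Σℚ-𝟙-disjoint≤1 {suc k} A disjoint i with 𝟙-∈-or-0 (A zero) i
... | inj₁ (i∈A₀ , 𝟙≡1) = ≤-reflexive (begin
  𝟙 (A zero) i + Σℚ (λ j → 𝟙 (A (suc j)) i) ≡⟨ cong₂ _+_ 𝟙≡1 (Σℚ-cong others-0) ⟩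
  1ℚ + Σℚ {k} (λ _ → 0ℚ)                     ≡⟨ cong (1ℚ +_) (trans (Σℚ-const k 0ℚ) (*-zeroʳ (ℕ→ℚ k))) ⟩
  1ℚ + 0ℚ                                    ≡⟨ +-identityʳ 1ℚ ⟩
  1ℚ                                         ∎)
  where
  open ≡-Reasoning
  others-0 : ∀ j → 𝟙 (A (suc j)) i ≡ 0ℚ
  others-0 j with 𝟙-∈-or-0 (A (suc j)) i
  ... | inj₁ (i∈Aⱼ , _) = ⊥-elim (disjoint zero (suc j) (λ ()) (i , x∈p∩q⁺ (i∈A₀ , i∈Aⱼ)))
  ... | inj₂ 𝟙≡0        = 𝟙≡0
... | inj₂ 𝟙≡0 = ≤-trans (≤-reflexive (trans (cong (_+ rest) 𝟙≡0) (+-identityˡ rest)))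
  (Σℚ-𝟙-disjoint≤1 (A ∘ suc) (λ a b a≢b → disjoint (suc a) (suc b) (a≢b ∘ suc-injective)) i)
  where
  rest = Σℚ (λ j → 𝟙 (A (suc j)) i)

Σℚ-size-disjoint≤n : (A : Fin k → Subset n) → PairwiseDisjoint A →
                     Σℚ (λ j → size (A j)) ≤ ℕ→ℚ n
Σℚ-size-disjoint≤n {n = n} A disjoint = begin
  Σℚ (λ j → Σℚ (𝟙 (A j)))          ≡⟨ Σℚ-comm (λ j i → 𝟙 (A j) i) ⟩
  Σℚ (λ i → Σℚ (λ j → 𝟙 (A j) i))  ≤⟨ Σℚ-mono-≤ (Σℚ-𝟙-disjoint≤1 A disjoint) ⟩
  Σℚ {n} (λ _ → 1ℚ)                ≡⟨ Σℚ-const n 1ℚ ⟩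
  ℕ→ℚ n * 1ℚ                       ≡⟨ *-identityʳ _ ⟩
  ℕ→ℚ n                            ∎
  where open ≤-Reasoning

vol-regular : (w : Weights n) {D : ℚ} → (∀ i → deg w i ≡ D) → ∀ A → vol w A ≡ size A * D
vol-regular w {D} regular A = trans (Σℚ-cong (λ i → cong (𝟙 A i *_) (regular i))) (*-distribʳ-Σℚ D (𝟙 A))

E-inner+E-cut≡vol : (w : Weights n) (A : Subset n) → E w A A + E w A (compl A) ≡ vol w A
E-inner+E-cut≡vol {n} w A = begin
  E w A A + E w A (compl A)                           ≡⟨ sym (Σℚ-distrib-+ inner cut) ⟩
  Σℚ (λ i → inner i + cut i)
    ≡⟨ Σℚ-cong (λ i → trans (sym (Σℚ-distrib-+ (inner-row i) (cut-row i))) (Σℚ-cong (split-row i))) ⟩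
  Σℚ (λ i → Σℚ (λ j → a i * w i j))                  ≡⟨ Σℚ-cong (λ i → *-distribˡ-Σℚ (a i) (w i)) ⟩
  vol w A                                             ∎
  where
  open ≡-Reasoning
  a c : Fin n → ℚ
  a = 𝟙 A
  c = 𝟙 (compl A)
  inner-row cut-row : Fin n → Fin n → ℚ
  inner-row i j = a i * a j * w i j
  cut-row   i j = a i * c j * w i j
  inner cut : Fin n → ℚ
  inner i = Σℚ (inner-row i)
  cut   i = Σℚ (cut-row i)
  split-row : ∀ i j → a i * a j * w i j + a i * c j * w i j ≡ a i * w i j
  split-row i j = begin
    a i * a j * w i j + a i * c j * w i j ≡⟨ solve 4 (λ x y z u → x :* y :* u :+ x :* z :* u := x :* (y :+ z) :* u)
                                                     refl (a i) (a j) (c j) (w i j) ⟩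
    a i * (a j + c j) * w i j             ≡⟨ cong (λ s → a i * s * w i j) (𝟙+𝟙-compl A j) ⟩
    a i * 1ℚ * w i j                      ≡⟨ cong (_* w i j) (*-identityʳ (a i)) ⟩
    a i * w i j                           ∎

E-inner≤size² : (w : Weights n) → (∀ i j → w i j ≤ 1ℚ) → ∀ A → E w A A ≤ size A * size A
E-inner≤size² {n} w w≤1 A = begin
  Σℚ (λ i → Σℚ (λ j → a i * a j * w i j))  ≤⟨ Σℚ-mono-≤ (λ i → Σℚ-mono-≤ (λ j → bound i j)) ⟩
  Σℚ (λ i → Σℚ (λ j → a i * a j))          ≡⟨ Σℚ-cong (λ i → *-distribˡ-Σℚ (a i) a) ⟩
  Σℚ (λ i → a i * size A)                  ≡⟨ *-distribʳ-Σℚ (size A) a ⟩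
  size A * size A                          ∎
  where
  open ≤-Reasoning
  a : Fin n → ℚ
  a = 𝟙 A
  bound : ∀ i j → a i * a j * w i j ≤ a i * a j
  bound i j = ≤-trans
    (*-monoˡ-≤-nonNeg (a i * a j) {{nonNegative (*-nonNeg (𝟙-nonNeg A i) (𝟙-nonNeg A j))}} (w≤1 i j))
    (≤-reflexive (*-identityʳ (a i * a j)))

φ-≥ : (w : Weights n) → (∀ i j → w i j ≤ 1ℚ) → ∀ A t → 0ℚ < vol w A →
      size A * size A ≤ t * vol w A → 1ℚ - t ≤ φ w A
φ-≥ w w≤1 A t vol>0 size²≤t·vol = ≤-÷₀ vol>0 (begin
  (1ℚ - t) * V         ≡⟨ solve 2 (λ t v → (con 1ℚ :- t) :* v := v :- t :* v) refl t V ⟩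
  V - t * V            ≤⟨ +-monoʳ-≤ V (neg-antimono-≤ size²≤t·vol) ⟩
  V - size A * size A  ≤⟨ +-monoʳ-≤ V (neg-antimono-≤ (E-inner≤size² w w≤1 A)) ⟩
  V - E w A A          ≡⟨ cong (_- E w A A) (sym (E-inner+E-cut≡vol w A)) ⟩
  E w A A + E w A (compl A) - E w A A
    ≡⟨ solve 2 (λ x y → x :+ y :- x := y) refl (E w A A) (E w A (compl A)) ⟩
  E w A (compl A)      ∎)
  where
  open ≤-Reasoning
  V : ℚ
  V = vol w A

square≤÷₀ : ∀ {S δ K N} → 0ℚ ≤ S → 0ℚ < δ → 0ℚ < K → K * S ≤ N →
            S * S ≤ (1ℚ ÷₀ (δ * K)) * (S * (δ * N))
square≤÷₀ {S} {δ} {K} {N} S≥0 δ>0 K>0 KS≤N = begin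
  S * S                  ≡⟨ sym (*-identityʳ (S * S)) ⟩
  S * S * 1ℚ             ≡⟨ cong (S * S *_) (sym (÷₀-*-cancel 1ℚ δK>0)) ⟩
  S * S * (t * (δ * K))  ≡⟨ solve 4 (λ s t d k → s :* s :* (t :* (d :* k)) := (t :* s :* d) :* (k :* s)) refl S t δ K ⟩
  (t * S * δ) * (K * S)  ≤⟨ *-monoˡ-≤-nonNeg (t * S * δ) {{nonNegative tSδ≥0}} KS≤N ⟩
  (t * S * δ) * N        ≡⟨ solve 4 (λ s t d n → (t :* s :* d) :* n := t :* (s :* (d :* n))) refl S t δ N ⟩
  t * (S * (δ * N))      ∎
  where
  open ≤-Reasoning
  t : ℚ
  t = 1ℚ ÷₀ (δ * K)
  δK>0 : 0ℚ < δ * K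
  δK>0 = *-pos δ>0 K>0
  tSδ≥0 : 0ℚ ≤ t * S * δ
  tSδ≥0 = *-nonNeg (*-nonNeg (÷₀-nonNeg (nonNegative⁻¹ 1ℚ) δK>0) S≥0) (<⇒≤ δ>0)

lemma5p17 : (n : ℕ) (w : Weights n) (δ : ℚ) →
    IsWeightedGraph w → 0ℚ < δ →
    ((i : Fin n) → deg w i ≡ δ * ℕ→ℚ n) →
    (k : ℕ) → .{{_ : NonZero k}} →
    ρ≥ w k (1ℚ - (1ℚ ÷₀ (δ * ℕ→ℚ k)))
lemma5p17 n w δ _ δ>0 regular zero {{k≢0}} = ⊥-elim-irr (NonZero.nonZero k≢0)
lemma5p17 n w δ (w∈[0,1] , _) δ>0 regular (suc k) A (nonempty , disjoint) =
  j , φ-≥ w (λ a b → proj₂ (w∈[0,1] a b)) (A j) t vol>0 (subst (λ v → S * S ≤ t * v) (sym vol≡) S²≤t·vol)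
  where
  t : ℚ
  t = 1ℚ ÷₀ (δ * ℕ→ℚ (suc k))
  small : ∃ λ j → ℕ→ℚ (suc k) * size (A j) ≤ ℕ→ℚ n
  small = pigeonhole (ℕ→ℚ n) (λ j → size (A j)) (Σℚ-size-disjoint≤n A disjoint)
  j : Fin (suc k)
  j = proj₁ small
  S : ℚ
  S = size (A j)
  S≥1 : 1ℚ ≤ S
  S≥1 = 1≤size (A j) (proj₂ (nonempty j))
  vol≡ : vol w (A j) ≡ S * (δ * ℕ→ℚ n)
  vol≡ = vol-regular w regular (A j)
  vol>0 : 0ℚ < vol w (A j)
  vol>0 = subst (0ℚ <_) (sym vol≡)
    (*-pos (<-≤-trans (positive⁻¹ 1ℚ) S≥1) (*-pos δ>0 (Fin⇒ℕ→ℚ-pos (proj₁ (nonempty j)))))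
  S²≤t·vol : S * S ≤ t * (S * (δ * ℕ→ℚ n))
  S²≤t·vol = square≤÷₀ (≤-trans (nonNegative⁻¹ 1ℚ) S≥1) δ>0 (ℕ→ℚ-pos k) (proj₂ small)
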